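{- Let $G$ be the star graph on nodes $\{1,\dots,n\}$ with center node $1$ (edges $\{1,i\}$ for $i=2,\dots,n$ and no others). Define $x$ by $x_{1i}=\frac12$ for $i=2,\dots,n$ and $x_{ij}=1$ for all distinct $i,j\in\{2,\dots,n\}$. Then $x$ is an optimal solution of the LambdaPrime LP relaxation of $G$ for every $\lambda\in\left(\frac1{n-1},\frac12\right)$.
   Context: The LambdaPrime LP relaxation of a graph $G=(V,E)$ with parameter $\lambda$ has variables $x_{ij}$ for unordered pairs $i<j$ of nodes: minimize $\sum_{(i,j)\in E}x_{ij}+\sum_{i<j}\lambda(1-x_{ij})$ subject to $x_{ij}\le x_{ik}+x_{jk}$ for all $i,j,k$ and $0\le x_{ij}\le1$.
   Formalization: The parameter λ is rational, and optimality of x is checked only against feasible points with rational coordinates. -}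

module Defs where

open import Data.Nat using (ℕ; zero; suc)
open import Data.Fin using (Fin; zero; suc)
open import Data.Fin.Properties using () renaming (_<?_ to _<ᶠ?_)
import Data.Fin as F
open import Data.Bool using (Bool; true; false; if_then_else_)
open import Data.Product using (_×_)
open import Data.Rational using (ℚ; 0ℚ; 1ℚ; ½; _+_; _-_; _*_; _≤_)
open import Relation.Nullary.Decidable using (⌊_⌋)
open import Relation.Binary.PropositionalEquality using (_≢_)

Graph : ℕ → Set
Graph n = Fin n → Fin n → Bool

-- Star graph with center node zero (the paper's node 1):
-- edges {0,i} for i ≠ 0 and no others.
star : (n : ℕ) → Graph n
star n zero    zero    = false
star n zero    (suc _) = true
star n (suc _) zero    = true
star n (suc _) (suc _) = false

-- Candidate LP points: x i j is the variable x_{ij}, only used for i < j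
-- (unordered pair {i,j} with i < j).
Point : ℕ → Set
Point n = Fin n → Fin n → ℚ

pr : ∀ {n} → Point n → Fin n → Fin n → ℚ
pr x i j = if ⌊ i <ᶠ? j ⌋ then x i j else x j i

sumFin : ∀ {n} → (Fin n → ℚ) → ℚ
sumFin {zero}  f = 0ℚ
sumFin {suc n} f = f zero + sumFin (λ i → f (suc i))

objective : ∀ {n} → Graph n → ℚ → Point n → ℚ
objective G lam x =
  sumFin (λ i → sumFin (λ j →
    if ⌊ i <ᶠ? j ⌋
      then (if G i j then x i j else 0ℚ) + lam * (1ℚ - x i j)
      else 0ℚ))

Feasible : ∀ {n} → Point n → Set
Feasible x =
  (∀ i j → i F.< j → (0ℚ ≤ x i j) × (x i j ≤ 1ℚ)) ×
  (∀ i j k → i ≢ j → i ≢ k → j ≢ k → pr x i j ≤ pr x i k + pr x j k)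

Optimal : ∀ {n} → Graph n → ℚ → Point n → Set
Optimal G lam x = Feasible x × (∀ y → Feasible y → objective G lam x ≤ objective G lam y)

xstar : (n : ℕ) → Point n
xstar n zero    _       = ½
xstar n (suc _) zero    = ½
xstar n (suc _) (suc _) = 1ℚ

module Submission where

-- Proof strategy (a dual certificate, written as a chain of inequalities).
-- Let the star have centre 0 and leaves 1..m, and let y be feasible with
-- spoke values aⱼ = y₀ⱼ and leaf-pair values bᵢⱼ.  The objective of y is
--   Σⱼ (aⱼ + λ(1 - aⱼ))  +  Σ_{i<j} λ(1 - bᵢⱼ).
-- Put eⱼ = ½ - aⱼ.  For any c with 0 ≤ c ≤ λ, the triangle inequality
-- bᵢⱼ ≤ aᵢ + aⱼ and bᵢⱼ ≤ 1 give λ(1 - bᵢⱼ) ≥ c(1 - aᵢ - aⱼ) = c(eᵢ + eⱼ),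
-- and summing over pairs, Σ_{i<j} (eᵢ + eⱼ) = (m - 1) Σⱼ eⱼ.  Choosing c with
-- c(m - 1) = 1 - λ, the objective of y is at least
--   Σⱼ (aⱼ + λ(1 - aⱼ) + (1 - λ)(½ - aⱼ)) = Σⱼ (½ + λ(1 - ½)),
-- which is exactly the objective of x* (its leaf pairs cost nothing).

open import Defs
open import Data.Nat using (ℕ; zero; suc; s≤s)
open import Data.Nat.Properties using (≤-pred)
open import Data.Nat.Coprimality using (1-coprimeTo) renaming (sym to coprime-sym)
open import Data.Integer using (+_)
import Data.Integer as ℤ
open import Data.Integer.Solver using (module +-*-Solver)
open import Data.Fin using (Fin; zero; suc)
import Data.Fin as F
open import Data.Fin.Properties using (suc-injective) renaming (_<?_ to _<ᶠ?_; <-irrefl to <ᶠ-irrefl)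
open import Data.Bool using (true; false; if_then_else_; T)
open import Data.Product using (_×_; _,_; proj₁; proj₂; Σ)
open import Data.Empty using (⊥-elim)
open import Data.Rational
  using (ℚ; mkℚ; 0ℚ; 1ℚ; ½; _+_; _-_; _*_; _≤_; _<_; -_; 1/_; _/_; _≤?_; _<?_; nonNegative)
open import Data.Rational.Properties
import Data.Rational.Unnormalised as ℚᵘ
import Data.Rational.Unnormalised.Properties as ℚᵘ
open import Data.Rational.Solver using (module +-*-Solver)
open import Relation.Nullary.Decidable using (⌊_⌋; yes; no; toWitness)
open import Relation.Binary.PropositionalEquality

open Data.Rational.Solver.+-*-Solver using (solve; con; _:+_; _:*_; _:-_; _:=_)

-- The rational numeral n/1; its denominator is definitionally 1, so
-- arithmetic facts about it reduce to integer identities.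
fromℕ : ℕ → ℚ
fromℕ n = mkℚ (+ n) 0 (coprime-sym (1-coprimeTo n))

fromℕ-suc : ∀ n → fromℕ (suc n) ≡ 1ℚ + fromℕ n
fromℕ-suc n = toℚᵘ-injective (ℚᵘ.≃-sym (ℚᵘ.≃-trans (toℚᵘ-homo-+ 1ℚ (fromℕ n))
                                                     (ℚᵘ.*≡* (cross-multiplied (+ n)))))
  where
  open Data.Integer.Solver.+-*-Solver
    using () renaming (solve to solveℤ; con to κ; _:+_ to _⊕_; _:*_ to _⊗_; _:=_ to _≐_)
  cross-multiplied : ∀ x → (+ 1 ℤ.* + 1 ℤ.+ x ℤ.* + 1) ℤ.* + 1 ≡ (+ 1 ℤ.+ x) ℤ.* (+ 1 ℤ.* + 1)
  cross-multiplied = solveℤ 1 (λ x → (κ (+ 1) ⊗ κ (+ 1) ⊕ x ⊗ κ (+ 1)) ⊗ κ (+ 1)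
                                    ≐ (κ (+ 1) ⊕ x) ⊗ (κ (+ 1) ⊗ κ (+ 1))) refl

-- `+ 1 / suc k` (the form used in the statement) is the inverse of suc k.
reciprocal-fromℕ : ∀ k → + 1 / suc k ≡ 1/ fromℕ (suc k)
reciprocal-fromℕ k = normalize-coprime (1-coprimeTo (suc k))

fromℕ-*-reciprocal : ∀ k → fromℕ (suc k) * (+ 1 / suc k) ≡ 1ℚ
fromℕ-*-reciprocal k =
  trans (cong (fromℕ (suc k) *_) (reciprocal-fromℕ k)) (*-inverseʳ (fromℕ (suc k)))

reciprocal-nonneg : ∀ k → 0ℚ ≤ + 1 / suc k
reciprocal-nonneg k = subst (0ℚ ≤_) (sym (reciprocal-fromℕ k)) (nonNegative⁻¹ _)

by-decision : (p r : ℚ) → {_ : T ⌊ p ≤? r ⌋} → p ≤ r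
by-decision p r {w} = toWitness {a? = p ≤? r} w

sumFin-cong : ∀ {n} {f g : Fin n → ℚ} → (∀ i → f i ≡ g i) → sumFin f ≡ sumFin g
sumFin-cong {zero}  e = refl
sumFin-cong {suc n} e = cong₂ _+_ (e zero) (sumFin-cong (λ i → e (suc i)))

sumFin-mono : ∀ {n} {f g : Fin n → ℚ} → (∀ i → f i ≤ g i) → sumFin f ≤ sumFin g
sumFin-mono {zero}  e = ≤-refl
sumFin-mono {suc n} e = +-mono-≤ (e zero) (sumFin-mono (λ i → e (suc i)))

sumFin-+ : ∀ {n} (f g : Fin n → ℚ) → sumFin (λ i → f i + g i) ≡ sumFin f + sumFin g
sumFin-+ {zero}  f g = refl
sumFin-+ {suc n} f g = begin
    (f zero + g zero) + sumFin (λ i → f (suc i) + g (suc i))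
  ≡⟨ cong (λ z → (f zero + g zero) + z) (sumFin-+ (λ i → f (suc i)) (λ i → g (suc i))) ⟩
    (f zero + g zero) + (sumFin (λ i → f (suc i)) + sumFin (λ i → g (suc i)))
  ≡⟨ +-interchange (f zero) (g zero) _ _ ⟩
    (f zero + sumFin (λ i → f (suc i))) + (g zero + sumFin (λ i → g (suc i))) ∎
  where
  open ≡-Reasoning
  +-interchange : ∀ a b s t → (a + b) + (s + t) ≡ (a + s) + (b + t)
  +-interchange = solve 4 (λ a b s t → (a :+ b) :+ (s :+ t) := (a :+ s) :+ (b :+ t)) refl

sumFin-scale : ∀ {n} c (f : Fin n → ℚ) → sumFin (λ i → c * f i) ≡ c * sumFin f
sumFin-scale {zero}  c f = sym (*-zeroʳ c)
sumFin-scale {suc n} c f =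
  trans (cong (λ z → c * f zero + z) (sumFin-scale c (λ i → f (suc i))))
        (sym (*-distribˡ-+ c (f zero) (sumFin (λ i → f (suc i)))))

sumFin-const : ∀ n a → sumFin {n} (λ _ → a) ≡ fromℕ n * a
sumFin-const zero    a = sym (*-zeroˡ a)
sumFin-const (suc n) a = begin
    a + sumFin {n} (λ _ → a)  ≡⟨ cong (λ z → a + z) (sumFin-const n a) ⟩
    a + fromℕ n * a           ≡⟨ cong (_+ fromℕ n * a) (sym (*-identityˡ a)) ⟩
    1ℚ * a + fromℕ n * a      ≡⟨ sym (*-distribʳ-+ a 1ℚ (fromℕ n)) ⟩
    (1ℚ + fromℕ n) * a        ≡⟨ cong (_* a) (sym (fromℕ-suc n)) ⟩
    fromℕ (suc n) * a         ∎
  where open ≡-Reasoning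

sumFin-zero : ∀ {n} {f : Fin n → ℚ} → (∀ i → f i ≡ 0ℚ) → sumFin f ≡ 0ℚ
sumFin-zero {zero}  e = refl
sumFin-zero {suc n} e = cong₂ _+_ (e zero) (sumFin-zero (λ i → e (suc i)))

-- Σ_{i<j} g i j, in exactly the shape in which `objective` adds up its terms.
pairSum : ∀ {n} → (Fin n → Fin n → ℚ) → ℚ
pairSum g = sumFin (λ i → sumFin (λ j → if ⌊ i <ᶠ? j ⌋ then g i j else 0ℚ))

guard-suc : ∀ {n} (i j : Fin n) (a : ℚ) →
  (if ⌊ suc i <ᶠ? suc j ⌋ then a else 0ℚ) ≡ (if ⌊ i <ᶠ? j ⌋ then a else 0ℚ)
guard-suc i j a with i <ᶠ? j | suc i <ᶠ? suc j
... | yes _  | yes _  = refl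
... | no _   | no _   = refl
... | yes i<j | no ¬si<sj = ⊥-elim (¬si<sj (s≤s i<j))
... | no ¬i<j | yes si<sj = ⊥-elim (¬i<j (≤-pred si<sj))

pairSum-split : ∀ {n} (g : Fin (suc n) → Fin (suc n) → ℚ) →
  pairSum g ≡ sumFin (λ j → g zero (suc j)) + pairSum (λ i j → g (suc i) (suc j))
pairSum-split {n} g = cong₂ _+_ (+-identityˡ (sumFin (λ j → g zero (suc j))))
  (sumFin-cong {n} (λ i → trans (+-identityˡ _)
                            (sumFin-cong (λ j → guard-suc i j (g (suc i) (suc j))))))

pairSum-cong : ∀ {n} {g h : Fin n → Fin n → ℚ} → (∀ i j → g i j ≡ h i j) → pairSum g ≡ pairSum h
pairSum-cong e = sumFin-cong (λ i → sumFin-cong (λ j → cong (λ z → if ⌊ i <ᶠ? _ ⌋ then z else 0ℚ) (e i j)))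

pairSum-mono : ∀ {n} {g h : Fin n → Fin n → ℚ} →
  (∀ i j → i F.< j → g i j ≤ h i j) → pairSum g ≤ pairSum h
pairSum-mono {g = g} {h} e = sumFin-mono (λ i → sumFin-mono (λ j → guarded i j))
  where
  guarded : ∀ i j → (if ⌊ i <ᶠ? j ⌋ then g i j else 0ℚ) ≤ (if ⌊ i <ᶠ? j ⌋ then h i j else 0ℚ)
  guarded i j with i <ᶠ? j
  ... | yes i<j = e i j i<j
  ... | no _    = ≤-refl

pairSum-scale : ∀ {n} c (g : Fin n → Fin n → ℚ) → pairSum (λ i j → c * g i j) ≡ c * pairSum g
pairSum-scale {n} c g = begin
    pairSum (λ i j → c * g i j)
  ≡⟨ sumFin-cong {n} (λ i → trans (sumFin-cong {n} (λ j → guarded-scale ⌊ i <ᶠ? j ⌋ (g i j))) (sumFin-scale c (λ j → if ⌊ i <ᶠ? j ⌋ then g i j else 0ℚ))) ⟩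
    sumFin (λ i → c * sumFin (λ j → if ⌊ i <ᶠ? j ⌋ then g i j else 0ℚ))
  ≡⟨ sumFin-scale c (λ i → sumFin (λ j → if ⌊ i <ᶠ? j ⌋ then g i j else 0ℚ)) ⟩
    c * pairSum g ∎
  where
  open ≡-Reasoning
  guarded-scale : ∀ b x → (if b then c * x else 0ℚ) ≡ c * (if b then x else 0ℚ)
  guarded-scale true  x = refl
  guarded-scale false x = sym (*-zeroʳ c)

pairSum-zero : ∀ {n} {g : Fin n → Fin n → ℚ} → (∀ i j → g i j ≡ 0ℚ) → pairSum g ≡ 0ℚ
pairSum-zero {g = g} e = sumFin-zero (λ i → sumFin-zero (λ j → guarded-zero ⌊ i <ᶠ? j ⌋ (e i j)))
  where
  guarded-zero : ∀ b {x} → x ≡ 0ℚ → (if b then x else 0ℚ) ≡ 0ℚ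
  guarded-zero true  x≡0 = x≡0
  guarded-zero false _   = refl

-- Each index lies in n - 1 pairs: Σ_{i<j} (fᵢ + fⱼ) = (n - 1) Σᵢ fᵢ.
pairSum-of-sums : ∀ n (f : Fin n → ℚ) → pairSum (λ i j → f i + f j) ≡ (fromℕ n - 1ℚ) * sumFin f
pairSum-of-sums zero    f = refl
pairSum-of-sums (suc n) f = begin
    pairSum (λ i j → f i + f j)
  ≡⟨ pairSum-split (λ i j → f i + f j) ⟩
    sumFin (λ j → f zero + f (suc j)) + pairSum (λ i j → f (suc i) + f (suc j))
  ≡⟨ cong₂ _+_ (trans (sumFin-+ (λ _ → f zero) (λ j → f (suc j))) (cong (_+ S) (sumFin-const n (f zero))))
               (pairSum-of-sums n (λ j → f (suc j))) ⟩
    (fromℕ n * f zero + S) + (fromℕ n - 1ℚ) * S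
  ≡⟨ solve 3 (λ N f₀ S → (N :* f₀ :+ S) :+ (N :- con 1ℚ) :* S := ((con 1ℚ :+ N) :- con 1ℚ) :* (f₀ :+ S))
             refl (fromℕ n) (f zero) S ⟩
    ((1ℚ + fromℕ n) - 1ℚ) * (f zero + S)
  ≡⟨ cong (λ N → (N - 1ℚ) * (f zero + S)) (sym (fromℕ-suc n)) ⟩
    (fromℕ (suc n) - 1ℚ) * sumFin f ∎
  where
  open ≡-Reasoning
  S = sumFin (λ j → f (suc j))

≤⇒0≤difference : ∀ {p r} → p ≤ r → 0ℚ ≤ r - p
≤⇒0≤difference {p} {r} p≤r = subst (_≤ r - p) (+-inverseʳ p) (+-monoˡ-≤ (- p) p≤r)

scaled-triangle : ∀ {lam c b s} → 0ℚ ≤ c → c ≤ lam → b ≤ 1ℚ → b ≤ s →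
  c * (1ℚ - s) ≤ lam * (1ℚ - b)
scaled-triangle {lam} {c} {b} {s} 0≤c c≤lam b≤1 b≤s = begin
  c * (1ℚ - s)    ≤⟨ *-monoˡ-≤-nonNeg c {{nonNegative 0≤c}} (+-monoʳ-≤ 1ℚ (neg-antimono-≤ b≤s)) ⟩
  c * (1ℚ - b)    ≤⟨ *-monoʳ-≤-nonNeg (1ℚ - b) {{nonNegative (≤⇒0≤difference b≤1)}} c≤lam ⟩
  lam * (1ℚ - b)  ∎
  where open ≤-Reasoning

objective-star : ∀ m lam (y : Point (suc m)) →
  objective (star (suc m)) lam y ≡
    sumFin (λ j → y zero (suc j) + lam * (1ℚ - y zero (suc j)))
    + pairSum (λ i j → lam * (1ℚ - y (suc i) (suc j)))
objective-star m lam y =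
  trans (pairSum-split (λ i j → (if star (suc m) i j then y i j else 0ℚ) + lam * (1ℚ - y i j)))
        (cong (λ z → sumFin (λ j → y zero (suc j) + lam * (1ℚ - y zero (suc j))) + z)
              (pairSum-cong (λ i j → +-identityˡ (lam * (1ℚ - y (suc i) (suc j))))))

pr-ordered : ∀ {n} (y : Point n) i j → i F.< j → pr y i j ≡ y i j
pr-ordered y i j i<j with i <ᶠ? j
... | yes _    = refl
... | no ¬i<j = ⊥-elim (¬i<j i<j)

-- What feasibility says about a pair of leaves: its value is at most 1 and
-- at most the sum of the two spokes (triangle through the centre).
leaf-pair-bounds : ∀ {m} (y : Point (suc m)) → Feasible y → ∀ (i j : Fin m) → i F.< j →
  (y (suc i) (suc j) ≤ 1ℚ) × (y (suc i) (suc j) ≤ y zero (suc i) + y zero (suc j))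
leaf-pair-bounds y (bounds , triangle) i j i<j = proj₂ (bounds (suc i) (suc j) si<sj) , through-centre
  where
  si<sj : suc i F.< suc j
  si<sj = s≤s i<j
  distinct : suc i ≢ suc j
  distinct e = <ᶠ-irrefl (suc-injective e) i<j
  through-centre : y (suc i) (suc j) ≤ y zero (suc i) + y zero (suc j)
  through-centre = subst (_≤ y zero (suc i) + y zero (suc j)) (pr-ordered y (suc i) (suc j) si<sj)
                         (triangle (suc i) (suc j) zero distinct (λ ()) (λ ()))

xstar-symmetric : ∀ {n} (i j : Fin n) → xstar n i j ≡ xstar n j i
xstar-symmetric zero    zero    = refl
xstar-symmetric zero    (suc j) = refl
xstar-symmetric (suc i) zero    = refl
xstar-symmetric (suc i) (suc j) = refl

pr-xstar : ∀ {n} (i j : Fin n) → pr (xstar n) i j ≡ xstar n i j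
pr-xstar i j with ⌊ i <ᶠ? j ⌋
... | true  = refl
... | false = xstar-symmetric j i

xstar-triangle : ∀ {n} (i j k : Fin n) → i ≢ j → i ≢ k → j ≢ k →
  xstar n i j ≤ xstar n i k + xstar n j k
xstar-triangle zero    zero    _       i≢j _   _   = ⊥-elim (i≢j refl)
xstar-triangle zero    (suc j) zero    _   i≢k _   = ⊥-elim (i≢k refl)
xstar-triangle (suc i) zero    zero    _   _   j≢k = ⊥-elim (j≢k refl)
xstar-triangle zero    (suc j) (suc k) _   _   _   = by-decision ½ (½ + 1ℚ)
xstar-triangle (suc i) zero    (suc k) _   _   _   = by-decision ½ (1ℚ + ½)
xstar-triangle (suc i) (suc j) zero    _   _   _   = by-decision 1ℚ (½ + ½)
xstar-triangle (suc i) (suc j) (suc k) _   _   _   = by-decision 1ℚ (1ℚ + 1ℚ)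

xstar-feasible : ∀ n → Feasible (xstar n)
xstar-feasible n = bounds , λ i j k i≢j i≢k j≢k →
  subst₂ _≤_ (sym (pr-xstar i j)) (sym (cong₂ _+_ (pr-xstar i k) (pr-xstar j k)))
         (xstar-triangle i j k i≢j i≢k j≢k)
  where
  bounds : ∀ (i j : Fin n) → i F.< j → (0ℚ ≤ xstar n i j) × (xstar n i j ≤ 1ℚ)
  bounds zero    j       _ = by-decision 0ℚ ½ , by-decision ½ 1ℚ
  bounds (suc i) zero    _ = by-decision 0ℚ ½ , by-decision ½ 1ℚ
  bounds (suc i) (suc j) _ = by-decision 0ℚ 1ℚ , ≤-refl

objective-xstar : ∀ m lam →
  objective (star (suc m)) lam (xstar (suc m)) ≡ sumFin {m} (λ _ → ½ + lam * (1ℚ - ½))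
objective-xstar m lam = begin
    objective (star (suc m)) lam (xstar (suc m))
  ≡⟨ objective-star m lam (xstar (suc m)) ⟩
    spokes + pairSum {m} (λ _ _ → lam * (1ℚ - 1ℚ))
  ≡⟨ cong (λ z → spokes + z) (pairSum-zero {m} (λ _ _ → trans (cong (lam *_) (+-inverseʳ 1ℚ)) (*-zeroʳ lam))) ⟩
    spokes + 0ℚ
  ≡⟨ +-identityʳ spokes ⟩
    spokes ∎
  where
  open ≡-Reasoning
  spokes = sumFin {m} (λ _ → ½ + lam * (1ℚ - ½))

-- c is a multiplier for the star with m leaves and parameter λ: it may
-- replace λ on leaf pairs (0 ≤ c ≤ λ) and its m - 1 shares of every spoke
-- add up to that spoke's excess cost 1 - λ.
Multiplier : ℕ → ℚ → ℚ → Set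
Multiplier m lam c = (0ℚ ≤ c) × (c ≤ lam) × (c * (fromℕ m - 1ℚ) ≡ 1ℚ - lam)

spread-over-pairs : ∀ m lam c (f : Fin m → ℚ) → c * (fromℕ m - 1ℚ) ≡ 1ℚ - lam →
  (1ℚ - lam) * sumFin f ≡ pairSum (λ i j → c * (f i + f j))
spread-over-pairs m lam c f balance = begin
  (1ℚ - lam) * sumFin f                 ≡⟨ cong (_* sumFin f) (sym balance) ⟩
  c * (fromℕ m - 1ℚ) * sumFin f         ≡⟨ *-assoc c (fromℕ m - 1ℚ) (sumFin f) ⟩
  c * ((fromℕ m - 1ℚ) * sumFin f)       ≡⟨ cong (c *_) (sym (pairSum-of-sums m f)) ⟩
  c * pairSum (λ i j → f i + f j)       ≡⟨ sym (pairSum-scale c (λ i j → f i + f j)) ⟩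
  pairSum (λ i j → c * (f i + f j))     ∎
  where open ≡-Reasoning

star-optimal : ∀ m lam c → Multiplier m lam c → Optimal (star (suc m)) lam (xstar (suc m))
star-optimal m lam c (0≤c , c≤lam , balance) = xstar-feasible (suc m) , x*-minimal
  where
  x*-minimal : ∀ y → Feasible y → objective (star (suc m)) lam (xstar (suc m)) ≤ objective (star (suc m)) lam y
  x*-minimal y feasible = begin
      objective (star (suc m)) lam (xstar (suc m))
    ≡⟨ objective-xstar m lam ⟩
      sumFin {m} (λ _ → ½ + lam * (1ℚ - ½))
    ≡⟨ sumFin-cong (λ j → spoke-identity (a j)) ⟩
      sumFin (λ j → spoke j + (1ℚ - lam) * e j)
    ≡⟨ trans (sumFin-+ spoke (λ j → (1ℚ - lam) * e j)) (cong (λ z → Σspoke + z) (sumFin-scale (1ℚ - lam) e)) ⟩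
      Σspoke + (1ℚ - lam) * sumFin e
    ≡⟨ cong (λ z → Σspoke + z) (spread-over-pairs m lam c e balance) ⟩
      Σspoke + pairSum (λ i j → c * (e i + e j))
    ≤⟨ +-monoʳ-≤ Σspoke (pairSum-mono pair-estimate) ⟩
      Σspoke + pairSum (λ i j → lam * (1ℚ - y (suc i) (suc j)))
    ≡⟨ sym (objective-star m lam y) ⟩
      objective (star (suc m)) lam y ∎
    where
    open ≤-Reasoning
    a e spoke : Fin m → ℚ
    a j = y zero (suc j)
    e j = ½ - a j
    spoke j = a j + lam * (1ℚ - a j)
    Σspoke : ℚ
    Σspoke = sumFin spoke
    spoke-identity : ∀ t → ½ + lam * (1ℚ - ½) ≡ (t + lam * (1ℚ - t)) + (1ℚ - lam) * (½ - t)
    spoke-identity t = solve 2 (λ t l → con ½ :+ l :* (con 1ℚ :- con ½)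
                                      := (t :+ l :* (con 1ℚ :- t)) :+ (con 1ℚ :- l) :* (con ½ :- t)) refl t lam
    pair-estimate : ∀ i j → i F.< j → c * (e i + e j) ≤ lam * (1ℚ - y (suc i) (suc j))
    pair-estimate i j i<j with leaf-pair-bounds y feasible i j i<j
    ... | b≤1 , b≤aᵢ+aⱼ = subst (_≤ lam * (1ℚ - y (suc i) (suc j))) (cong (c *_) (halves (a i) (a j)))
                                (scaled-triangle 0≤c c≤lam b≤1 b≤aᵢ+aⱼ)
      where
      halves : ∀ s t → 1ℚ - (s + t) ≡ (½ - s) + (½ - t)
      halves = solve 2 (λ s t → con 1ℚ :- (s :+ t) := (con ½ :- s) :+ (con ½ :- t)) refl

-- For λ ∈ (1/m, 1] with m ≥ 2 leaves, c = (1 - λ)/(m - 1) is a multiplier;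
-- the inequality c ≤ λ rearranges to 1 ≤ mλ.
multiplier-exists : ∀ k lam → + 1 / suc (suc k) < lam → lam ≤ 1ℚ →
  Σ ℚ (Multiplier (suc (suc k)) lam)
multiplier-exists k lam 1/m<lam lam≤1 = c , 0≤c , c≤lam , balance
  where
  M K c : ℚ
  M = fromℕ (suc (suc k))
  K = fromℕ (suc k)
  c = (1ℚ - lam) * (+ 1 / suc k)
  M≡1+K : M ≡ 1ℚ + K
  M≡1+K = fromℕ-suc (suc k)
  c*K : c * K ≡ 1ℚ - lam
  c*K = begin
    (1ℚ - lam) * (+ 1 / suc k) * K     ≡⟨ *-assoc (1ℚ - lam) (+ 1 / suc k) K ⟩
    (1ℚ - lam) * ((+ 1 / suc k) * K)   ≡⟨ cong ((1ℚ - lam) *_) (*-comm (+ 1 / suc k) K) ⟩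
    (1ℚ - lam) * (K * (+ 1 / suc k))   ≡⟨ cong ((1ℚ - lam) *_) (fromℕ-*-reciprocal k) ⟩
    (1ℚ - lam) * 1ℚ                    ≡⟨ *-identityʳ (1ℚ - lam) ⟩
    1ℚ - lam                           ∎
    where open ≡-Reasoning
  balance : c * (M - 1ℚ) ≡ 1ℚ - lam
  balance = trans (cong (λ N → c * (N - 1ℚ)) M≡1+K)
                  (trans (cong (c *_) (solve 1 (λ K → (con 1ℚ :+ K) :- con 1ℚ := K) refl K)) c*K)
  0≤c : 0ℚ ≤ c
  0≤c = nonNegative⁻¹ c {{nonNeg*nonNeg⇒nonNeg (1ℚ - lam) {{nonNegative (≤⇒0≤difference lam≤1)}}
                                               (+ 1 / suc k) {{nonNegative (reciprocal-nonneg k)}}}}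
  1≤Mλ : 1ℚ ≤ M * lam
  1≤Mλ = <⇒≤ (subst (_< M * lam) (fromℕ-*-reciprocal (suc k)) (*-monoʳ-<-pos M 1/m<lam))
  c≤lam : c ≤ lam
  c≤lam = *-cancelʳ-≤-pos K (begin
    c * K          ≡⟨ c*K ⟩
    1ℚ - lam       ≤⟨ +-monoˡ-≤ (- lam) 1≤Mλ ⟩
    M * lam - lam  ≡⟨ cong (λ N → N * lam - lam) M≡1+K ⟩
    (1ℚ + K) * lam - lam  ≡⟨ solve 2 (λ K l → (con 1ℚ :+ K) :* l :- l := l :* K) refl K lam ⟩
    lam * K        ∎)
    where open ≤-Reasoning

theorem8 : (k : ℕ) (lam : ℚ) →
    (+ 1 / suc k) < lam → lam < ½ →
    Optimal (star (suc (suc k))) lam (xstar (suc (suc k)))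
theorem8 zero    lam 1<lam lam<½ = ⊥-elim (<-asym (<-trans 1<lam lam<½) ½<1)
  where
  ½<1 : ½ < 1ℚ
  ½<1 = toWitness {a? = ½ <? 1ℚ} _
theorem8 (suc k) lam 1/m<lam lam<½ = star-optimal (suc (suc k)) lam (proj₁ multiplier) (proj₂ multiplier)
  where
  multiplier : Σ ℚ (Multiplier (suc (suc k)) lam)
  multiplier = multiplier-exists k lam 1/m<lam (<⇒≤ (<-≤-trans lam<½ (by-decision ½ 1ℚ)))
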